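{- Let $q$ be an odd prime power and $\chi_1$ the coloring defined below on $V=(\mathbb{F}_q^*)^3$. Let $a,b,c,d,e\in V$ be distinct vectors such that $\{a,b\}$ is linearly independent, $\chi_1(a,c)=\chi_1(a,d)=\chi_1(a,e)$, and $\chi_1(b,c)=\chi_1(b,d)=\chi_1(b,e)$. Then the three edges $\{c,d\},\{c,e\},\{d,e\}$ receive three distinct colors under $\chi_1$.
   Context: $q$ is an odd prime power, $\mathbb{F}_q^*$ the nonzero elements of $\mathbb{F}_q$, and $V=(\mathbb{F}_q^*)^3$. For $x,y\in\mathbb{F}_q^3$, $x\cdot y=x_1y_1+x_2y_2+x_3y_3$. Fix an arbitrary linear order $<$ on $\mathbb{F}_q$ and extend it lexicographically to vectors: $x<y$ iff $x_i<y_i$ at the first position $i$ where $x_i\neq y_i$. For distinct $x,y\in V$ define $T(x,y)$ to be: $\mathrm{UP}_1$ if $x\cdot y=x\cdot x$ and $x_1<y_1$; $\mathrm{UP}_2$ if $x\cdot y=x\cdot x$, $x_1=y_1$ and $x<y$; $\mathrm{DOWN}_1$ if $x\cdot y\ne x\cdot x$, $x\cdot y=y\cdot y$ and $x_1<y_1$; $\mathrm{DOWN}_2$ if $x\cdot y\neq x\cdot x$, $x\cdot y=y\cdot y$, $x_1=y_1$ and $x<y$; $\mathrm{ZERO}$ if $x\cdot y\notin\{x\cdot x,y\cdot y\}$ and $x\cdot y=0$; $\mathrm{DOT}$ otherwise. Let $f_T(x,y)=x_1+y_1$ if $T\in\{\mathrm{UP}_1,\mathrm{DOWN}_1,\mathrm{ZERO}\}$,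 $f_T(x,y)=x_2+y_2$ if $T\in\{\mathrm{UP}_2,\mathrm{DOWN}_2\}$, and $f_T(x,y)=x\cdot y$ if $T=\mathrm{DOT}$. Let $\delta(x,y)=0$ if $\{x,y\}$ is linearly dependent and $1$ otherwise. For $x<y$ set $\chi_1(x,y)=(T,f_T(x,y),\delta(x,y))$ with $T=T(x,y)$; this is the color of the edge $\{x,y\}$, so $\chi_1(y,x)=\chi_1(x,y)$. -}

module Defs where

open import Level using (0ℓ)
open import Data.Nat using (ℕ)
open import Data.Fin using (Fin)
open import Data.Fin.Properties using (any?)
open import Data.Product using (Σ; ∃; ∃₂; _×_; _,_; proj₁; proj₂)
open import Data.Product.Properties using (≡-dec)
open import Data.Sum using (_⊎_; inj₁; inj₂)
open import Relation.Nullary using (¬_; Dec; yes; no)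
open import Relation.Nullary.Decidable using (_×-dec_; _⊎-dec_; ¬?; map′)
open import Relation.Binary using (Rel; IsStrictTotalOrder; DecidableEquality)
open import Relation.Binary.PropositionalEquality using (_≡_; _≢_; refl; cong)
open import Algebra.Structures using (IsCommutativeRing)
open import Function.Bundles using (_↔_; Inverse)

record FiniteField (q : ℕ) : Set₁ where
  infixl 6 _+_
  infixl 7 _*_
  field
    Carrier           : Set
    _+_ _*_           : Carrier → Carrier → Carrier
    -_                : Carrier → Carrier
    0# 1#             : Carrier
    isCommutativeRing : IsCommutativeRing _≡_ _+_ _*_ -_ 0# 1#
    0≢1               : 0# ≢ 1#
    inverse           : ∀ x → x ≢ 0# → ∃ λ y → x * y ≡ 1#
    _≟_               : DecidableEquality Carrier
    enumeration       : Carrier ↔ Fin q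

module Coloring {q : ℕ} (F : FiniteField q)
                {_<_ : Rel (FiniteField.Carrier F) 0ℓ}
                (sto : IsStrictTotalOrder _≡_ _<_) where

  open FiniteField F
  open IsStrictTotalOrder sto using (_<?_)

  Vec3 : Set
  Vec3 = Carrier × Carrier × Carrier

  c₁ c₂ c₃ : Vec3 → Carrier
  c₁ (x , _ , _) = x
  c₂ (_ , y , _) = y
  c₃ (_ , _ , z) = z

  InV : Vec3 → Set
  InV x = c₁ x ≢ 0# × c₂ x ≢ 0# × c₃ x ≢ 0#

  _·_ : Vec3 → Vec3 → Carrier
  x · y = c₁ x * c₁ y + c₂ x * c₂ y + c₃ x * c₃ y

  _≟ᵥ_ : DecidableEquality Vec3
  _≟ᵥ_ = ≡-dec _≟_ (≡-dec _≟_ _≟_)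

  _<ₗ_ : Vec3 → Vec3 → Set
  x <ₗ y = c₁ x < c₁ y
         ⊎ (c₁ x ≡ c₁ y × (c₂ x < c₂ y ⊎ (c₂ x ≡ c₂ y × c₃ x < c₃ y)))

  _<ₗ?_ : ∀ x y → Dec (x <ₗ y)
  x <ₗ? y = (c₁ x <? c₁ y) ⊎-dec ((c₁ x ≟ c₁ y) ×-dec
              ((c₂ x <? c₂ y) ⊎-dec ((c₂ x ≟ c₂ y) ×-dec (c₃ x <? c₃ y))))

  scale : Carrier → Vec3 → Vec3
  scale α (x , y , z) = (α * x , α * y , α * z)

  _⊕_ : Vec3 → Vec3 → Vec3
  (x , y , z) ⊕ (x' , y' , z') = (x + x' , y + y' , z + z')

  zeroV : Vec3
  zeroV = (0# , 0# , 0#)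

  LinDep : Vec3 → Vec3 → Set
  LinDep x y = ∃₂ λ α β → (α ≢ 0# ⊎ β ≢ 0#) × (scale α x ⊕ scale β y ≡ zeroV)

  ∃? : {P : Carrier → Set} → (∀ x → Dec (P x)) → Dec (∃ P)
  ∃? {P} P? = map′ (λ { (i , p) → Inverse.from enumeration i , p })
                   (λ { (x , p) → Inverse.to enumeration x , back x p })
                   (any? (λ i → P? (Inverse.from enumeration i)))
    where
      back : ∀ x → P x → P (Inverse.from enumeration (Inverse.to enumeration x))
      back x p rewrite Inverse.strictlyInverseʳ enumeration x = p

  LinDep? : ∀ x y → Dec (LinDep x y)
  LinDep? x y = ∃? λ α → ∃? λ β →
    (¬? (α ≟ 0#) ⊎-dec ¬? (β ≟ 0#)) ×-dec ((scale α x ⊕ scale β y) ≟ᵥ zeroV)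

  δ : Vec3 → Vec3 → ℕ
  δ x y with LinDep? x y
  ... | yes _ = 0
  ... | no  _ = 1

  data EdgeType : Set where
    UP₁ UP₂ DOWN₁ DOWN₂ ZERO DOT : EdgeType

  -- the type T(x,y), following the case list literally (first matching case)
  T : Vec3 → Vec3 → EdgeType
  T x y with (x · y) ≟ (x · x) | (x · y) ≟ (y · y) | c₁ x <? c₁ y
           | c₁ x ≟ c₁ y | x <ₗ? y | (x · y) ≟ 0#
  ... | yes _ | _     | yes _ | _     | _     | _     = UP₁
  ... | yes _ | _     | no  _ | yes _ | yes _ | _     = UP₂
  ... | no  _ | yes _ | yes _ | _     | _     | _     = DOWN₁
  ... | no  _ | yes _ | no  _ | yes _ | yes _ | _     = DOWN₂
  ... | no  _ | no  _ | _     | _     | _     | yes _ = ZERO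
  ... | _     | _     | _     | _     | _     | _     = DOT

  f : EdgeType → Vec3 → Vec3 → Carrier
  f UP₁   x y = c₁ x + c₁ y
  f DOWN₁ x y = c₁ x + c₁ y
  f ZERO  x y = c₁ x + c₁ y
  f UP₂   x y = c₂ x + c₂ y
  f DOWN₂ x y = c₂ x + c₂ y
  f DOT   x y = x · y

  Color : Set
  Color = EdgeType × Carrier × ℕ

  -- χ₁ on an ordered pair with x <ₗ y
  χ₁< : Vec3 → Vec3 → Color
  χ₁< x y = (T x y , f (T x y) x y , δ x y)

  χ₁ : Vec3 → Vec3 → Color
  χ₁ x y with x <ₗ? y
  ... | yes _ = χ₁< x y
  ... | no  _ = χ₁< y x

-- For a fixed endpoint w, the color of an edge {w, p} imposes a single condition on p:
-- together with w it reveals which endpoint of the edge w is, so either p lies on a plane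
-- w · p = k, or w · p = p · p with c₁ p fixed.  Hence c, d, e lie on one such locus of a
-- and on one of b.  In every combination, two of the planes a · p = k, b · p = k, c₁ p = k
-- and (a − b) · p = 0 contain c, d, e and have independent normals, so c, d, e are
-- collinear.  A repeated color at a vertex x of the triangle then forces x · y = x · x, or
-- c₁ x = c₁ y, or three points of a locus of a on a line parallel to the third axis, which
-- a plane meets once and the quadric a · p = p · p at most twice.

module Submission where

open import Defs
open import Level using (0ℓ)
open import Data.Nat using (ℕ; suc; _^_)
open import Data.Nat.Divisibility using (_∣_)
open import Data.Nat.Primality using (Prime)
open import Data.Product using (∃₂; _×_)
open import Relation.Nullary using (¬_)
open import Relation.Binary using (Rel; IsStrictTotalOrder)
open import Relation.Binary.PropositionalEquality using (_≡_; _≢_)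

open import Algebra.Bundles using (CommutativeRing)
open import Algebra.Core using (Op₁; Op₂)
open import Algebra.Structures using (IsCommutativeRing)
import Algebra.Solver.Ring.AlmostCommutativeRing as AlmostCommutativeRing
open import Data.Bool.Base using (if_then_else_)
open import Data.Empty using (⊥; ⊥-elim)
open import Data.Integer.Base as ℤ using (ℤ; -[1+_]; _⊖_; _◃_; sign; ∣_∣)
import Data.Integer.Properties as ℤ
open import Data.Maybe.Base using (map)
import Data.Nat.Base as ℕ
import Data.Nat.Properties as ℕ
open import Data.Product using (∃; _,_; proj₁; proj₂)
open import Data.Product.Relation.Binary.Lex.Strict using (×-isStrictTotalOrder)
open import Data.Product.Relation.Binary.Pointwise.NonDependent using (≡×≡⇒≡)
open import Data.Sign.Base as Sign using (Sign)
open import Data.Sum using (inj₁; inj₂)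
open import Function.Base using (_∘_)
open import Relation.Binary.Consequences using (dec⇒weaklyDec)
open import Relation.Binary.Definitions using (tri<; tri≈; tri>)
open import Relation.Binary.PropositionalEquality
  using (refl; sym; trans; cong; cong₂; subst; ≢-sym; module ≡-Reasoning)
open import Relation.Nullary using (Dec; yes; no; does)

module ℤ-CoefficientSolver
  {A : Set} {add mul : Op₂ A} {neg : Op₁ A} {zero one : A}
  (isCommutativeRing : IsCommutativeRing _≡_ add mul neg zero one) where

  commutativeRing : CommutativeRing 0ℓ 0ℓ
  commutativeRing = record { isCommutativeRing = isCommutativeRing }

  -- The solver decides equality of normal forms by computing with coefficients, which
  -- the ring's own elements do not do (1# * 1# is not 1#); integers are used instead,
  -- through the canonical homomorphism ℤ → R.

  open CommutativeRing commutativeRing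
    using (_+_; _*_; -_; 0#; 1#; +-comm; +-assoc; +-identityˡ; +-identityʳ; -‿inverseʳ;
           *-identityˡ; zeroʳ; semiring; ring; +-abelianGroup; *-commutativeSemigroup)
  open import Algebra.Properties.Semiring.Mult semiring
    using (×-homo-+; ×1-homo-*) renaming (_×_ to _×ᴿ_)
  open import Algebra.Properties.Ring ring using (-1*x≈-x; -‿involutive; -0#≈0#)
  open import Algebra.Properties.AbelianGroup +-abelianGroup using (⁻¹-∙-comm)
  open import Algebra.Properties.CommutativeSemigroup *-commutativeSemigroup using (interchange)
  open ≡-Reasoning

  ⟦_⟧ : ℤ → A
  ⟦ ℤ.+ n ⟧      = n ×ᴿ 1#
  ⟦ -[1+ n ] ⟧ = - (suc n ×ᴿ 1#)

  ⟦⊖⟧ : ∀ m n → ⟦ m ⊖ n ⟧ ≡ m ×ᴿ 1# + - (n ×ᴿ 1#)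
  ⟦⊖⟧ m       0       = sym (trans (cong ((m ×ᴿ 1#) +_) -0#≈0#) (+-identityʳ _))
  ⟦⊖⟧ 0       (suc n) = sym (+-identityˡ _)
  ⟦⊖⟧ (suc m) (suc n) = begin
    ⟦ suc m ⊖ suc n ⟧                 ≡⟨ cong ⟦_⟧ (ℤ.[1+m]⊖[1+n]≡m⊖n m n) ⟩
    ⟦ m ⊖ n ⟧                         ≡⟨ ⟦⊖⟧ m n ⟩
    a + - b                           ≡⟨ cong (a +_) (+-identityˡ (- b)) ⟨
    a + (0# + - b)                    ≡⟨ cong (λ t → a + (t + - b)) (-‿inverseʳ 1#) ⟨
    a + ((1# + - 1#) + - b)           ≡⟨ cong (a +_) (+-assoc 1# (- 1#) (- b)) ⟩
    a + (1# + (- 1# + - b))           ≡⟨ +-assoc a 1# _ ⟨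
    (a + 1#) + (- 1# + - b)           ≡⟨ cong₂ _+_ (+-comm a 1#) (⁻¹-∙-comm 1# b) ⟩
    (1# + a) + - (1# + b)             ∎
    where a = m ×ᴿ 1#; b = n ×ᴿ 1#

  ⟦+⟧ : ∀ i j → ⟦ i ℤ.+ j ⟧ ≡ ⟦ i ⟧ + ⟦ j ⟧
  ⟦+⟧ (ℤ.+ m)    (ℤ.+ n)    = ×-homo-+ 1# m n
  ⟦+⟧ (ℤ.+ m)    -[1+ n ] = ⟦⊖⟧ m (suc n)
  ⟦+⟧ -[1+ m ] (ℤ.+ n)    = trans (⟦⊖⟧ n (suc m)) (+-comm _ _)
  ⟦+⟧ -[1+ m ] -[1+ n ] = begin
    - (suc (suc (m ℕ.+ n)) ×ᴿ 1#)       ≡⟨ cong (λ k → - (suc k ×ᴿ 1#)) (ℕ.+-suc m n) ⟨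
    - ((suc m ℕ.+ suc n) ×ᴿ 1#)         ≡⟨ cong -_ (×-homo-+ 1# (suc m) (suc n)) ⟩
    - (suc m ×ᴿ 1# + suc n ×ᴿ 1#)       ≡⟨ ⁻¹-∙-comm _ _ ⟨
    - (suc m ×ᴿ 1#) + - (suc n ×ᴿ 1#)   ∎

  ⟦_⟧ˢ : Sign → A
  ⟦ Sign.+ ⟧ˢ = 1#
  ⟦ Sign.- ⟧ˢ = - 1#

  ⟦*⟧ˢ : ∀ s t → ⟦ s Sign.* t ⟧ˢ ≡ ⟦ s ⟧ˢ * ⟦ t ⟧ˢ
  ⟦*⟧ˢ Sign.+ t      = sym (*-identityˡ _)
  ⟦*⟧ˢ Sign.- Sign.+ = sym (-1*x≈-x 1#)
  ⟦*⟧ˢ Sign.- Sign.- = sym (trans (-1*x≈-x (- 1#)) (-‿involutive 1#))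

  ⟦◃⟧ : ∀ s n → ⟦ s ◃ n ⟧ ≡ ⟦ s ⟧ˢ * (n ×ᴿ 1#)
  ⟦◃⟧ s      0       = sym (zeroʳ _)
  ⟦◃⟧ Sign.+ (suc n) = sym (*-identityˡ _)
  ⟦◃⟧ Sign.- (suc n) = sym (-1*x≈-x _)

  ⟦⟧-sign-abs : ∀ i → ⟦ i ⟧ ≡ ⟦ sign i ⟧ˢ * (∣ i ∣ ×ᴿ 1#)
  ⟦⟧-sign-abs (ℤ.+ n)    = sym (*-identityˡ _)
  ⟦⟧-sign-abs -[1+ n ] = sym (-1*x≈-x _)

  ⟦*⟧ : ∀ i j → ⟦ i ℤ.* j ⟧ ≡ ⟦ i ⟧ * ⟦ j ⟧
  ⟦*⟧ i j = begin
    ⟦ sign i Sign.* sign j ◃ ∣ i ∣ ℕ.* ∣ j ∣ ⟧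
      ≡⟨ ⟦◃⟧ (sign i Sign.* sign j) (∣ i ∣ ℕ.* ∣ j ∣) ⟩
    ⟦ sign i Sign.* sign j ⟧ˢ * ((∣ i ∣ ℕ.* ∣ j ∣) ×ᴿ 1#)
      ≡⟨ cong₂ _*_ (⟦*⟧ˢ (sign i) (sign j)) (×1-homo-* ∣ i ∣ ∣ j ∣) ⟩
    (⟦ sign i ⟧ˢ * ⟦ sign j ⟧ˢ) * ((∣ i ∣ ×ᴿ 1#) * (∣ j ∣ ×ᴿ 1#))
      ≡⟨ interchange _ _ _ _ ⟩
    (⟦ sign i ⟧ˢ * (∣ i ∣ ×ᴿ 1#)) * (⟦ sign j ⟧ˢ * (∣ j ∣ ×ᴿ 1#))
      ≡⟨ cong₂ _*_ (⟦⟧-sign-abs i) (⟦⟧-sign-abs j) ⟨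
    ⟦ i ⟧ * ⟦ j ⟧ ∎

  ⟦-⟧ : ∀ i → ⟦ ℤ.- i ⟧ ≡ - ⟦ i ⟧
  ⟦-⟧ -[1+ n ]    = sym (-‿involutive _)
  ⟦-⟧ (ℤ.+ 0)       = sym -0#≈0#
  ⟦-⟧ (ℤ.+ (suc n)) = refl

  homomorphism : CommutativeRing.rawRing ℤ.+-*-commutativeRing
                   AlmostCommutativeRing.-Raw-AlmostCommutative⟶
                 AlmostCommutativeRing.fromCommutativeRing commutativeRing
  homomorphism = record
    { ⟦_⟧ = ⟦_⟧ ; +-homo = ⟦+⟧ ; *-homo = ⟦*⟧ ; -‿homo = ⟦-⟧
    ; 0-homo = refl ; 1-homo = +-identityʳ 1# }

  open import Algebra.Solver.Ring _ _ homomorphism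
    (λ i j → map (cong ⟦_⟧) (dec⇒weaklyDec ℤ._≟_ i j)) public
    using (solve; _:=_; _:+_; _:*_; :-_; _:-_)

module FieldFacts {q : ℕ} (F : FiniteField q) where

  open FiniteField F
  open ℤ-CoefficientSolver isCommutativeRing public
    using (commutativeRing; solve; _:=_; _:+_; _:*_; :-_; _:-_)
  open CommutativeRing commutativeRing public
    using (+-comm; *-comm; +-identityˡ; +-identityʳ; *-identityˡ; *-identityʳ; zeroˡ; zeroʳ)
  open import Algebra.Properties.Group (CommutativeRing.+-group commutativeRing)
    using (quasigroup; x∙y⁻¹≈ε⇒x≈y; x≈y⇒x∙y⁻¹≈ε)
  open import Algebra.Properties.Quasigroup quasigroup using (cancelˡ)
  open ≡-Reasoning

  private variable a b c x y : Carrier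

  x-y≡0⇒x≡y : x + - y ≡ 0# → x ≡ y
  x-y≡0⇒x≡y = x∙y⁻¹≈ε⇒x≈y _ _

  x≡y⇒x-y≡0 : x ≡ y → x + - y ≡ 0#
  x≡y⇒x-y≡0 = x≈y⇒x∙y⁻¹≈ε

  +-cancelˡ : a + x ≡ a + y → x ≡ y
  +-cancelˡ = cancelˡ _ _ _

  x+y-x≡y : ∀ x y → x + y + - x ≡ y
  x+y-x≡y = solve 2 (λ x y → x :+ y :- x := y) refl

  x+y-y≡x : ∀ x y → x + y + - y ≡ x
  x+y-y≡x = solve 2 (λ x y → x :+ y :- y := x) refl

  x*b≡y*c⇒x≡y*b⁻¹*c : ∀ {b⁻¹} → b * b⁻¹ ≡ 1# → x * b ≡ y * c → x ≡ y * b⁻¹ * c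
  x*b≡y*c⇒x≡y*b⁻¹*c {b} {x} {y} {c} {b⁻¹} bb⁻¹≡1 xb≡yc = begin
    x                ≡⟨ *-identityʳ x ⟨
    x * 1#           ≡⟨ cong (x *_) bb⁻¹≡1 ⟨
    x * (b * b⁻¹)    ≡⟨ solve 3 (λ x b b⁻¹ → x :* (b :* b⁻¹) := x :* b :* b⁻¹) refl x b b⁻¹ ⟩
    x * b * b⁻¹      ≡⟨ cong (_* b⁻¹) xb≡yc ⟩
    y * c * b⁻¹      ≡⟨ solve 3 (λ y c b⁻¹ → y :* c :* b⁻¹ := y :* b⁻¹ :* c) refl y c b⁻¹ ⟩
    y * b⁻¹ * c      ∎

  *-cancelˡ : a ≢ 0# → a * x ≡ a * y → x ≡ y
  *-cancelˡ {a} {x} {y} a≢0 ax≡ay with a⁻¹ , aa⁻¹≡1 ← inverse a a≢0 = begin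
    x                ≡⟨ x*b≡y*c⇒x≡y*b⁻¹*c aa⁻¹≡1 (trans (*-comm x a) (trans ax≡ay (*-comm a y))) ⟩
    y * a⁻¹ * a      ≡⟨ solve 3 (λ y a a⁻¹ → y :* a⁻¹ :* a := y :* (a :* a⁻¹)) refl y a a⁻¹ ⟩
    y * (a * a⁻¹)    ≡⟨ cong (y *_) aa⁻¹≡1 ⟩
    y * 1#           ≡⟨ *-identityʳ y ⟩
    y                ∎

-- Coloring takes the order as a parameter; the geometry below does not use it.
module Geometry {q : ℕ} (F : FiniteField q) {_<_ : Rel (FiniteField.Carrier F) 0ℓ}
                (sto : IsStrictTotalOrder _≡_ _<_) where

  open FiniteField F
  open FieldFacts F
  open Coloring F sto
  open ≡-Reasoning

  private variable a b x y z u v w n A B : Vec3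

  infixl 6 _−_

  _−_ : Vec3 → Vec3 → Vec3
  (x₁ , x₂ , x₃) − (y₁ , y₂ , y₃) = (x₁ + - y₁ , x₂ + - y₂ , x₃ + - y₃)

  _⨯_ : Vec3 → Vec3 → Vec3
  (a₁ , a₂ , a₃) ⨯ (b₁ , b₂ , b₃) =
    (a₂ * b₃ + - (a₃ * b₂) , a₃ * b₁ + - (a₁ * b₃) , a₁ * b₂ + - (a₂ * b₁))

  e₁ e₂ : Vec3
  e₁ = (1# , 0# , 0#)
  e₂ = (0# , 1# , 0#)

  ·-comm : ∀ x y → x · y ≡ y · x
  ·-comm (x₁ , x₂ , x₃) (y₁ , y₂ , y₃) =
    cong₂ _+_ (cong₂ _+_ (*-comm x₁ y₁) (*-comm x₂ y₂)) (*-comm x₃ y₃)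

  ·-distribˡ-− : ∀ v x y → v · (x − y) ≡ v · x + - (v · y)
  ·-distribˡ-− (v₁ , v₂ , v₃) (x₁ , x₂ , x₃) (y₁ , y₂ , y₃) =
    solve 9 (λ v₁ v₂ v₃ x₁ x₂ x₃ y₁ y₂ y₃ →
      v₁ :* (x₁ :- y₁) :+ v₂ :* (x₂ :- y₂) :+ v₃ :* (x₃ :- y₃)
        := v₁ :* x₁ :+ v₂ :* x₂ :+ v₃ :* x₃ :- (v₁ :* y₁ :+ v₂ :* y₂ :+ v₃ :* y₃))
      refl v₁ v₂ v₃ x₁ x₂ x₃ y₁ y₂ y₃

  ·-distribʳ-− : ∀ x y v → (x − y) · v ≡ x · v + - (y · v)
  ·-distribʳ-− x y v = begin
    (x − y) · v         ≡⟨ ·-comm (x − y) v ⟩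
    v · (x − y)         ≡⟨ ·-distribˡ-− v x y ⟩
    v · x + - (v · y)   ≡⟨ cong₂ (λ s t → s + - t) (·-comm v x) (·-comm v y) ⟩
    x · v + - (y · v)   ∎

  ·-≡⇒·−≡0 : v · x ≡ v · y → v · (x − y) ≡ 0#
  ·-≡⇒·−≡0 {v} {x} {y} eq = trans (·-distribˡ-− v x y) (x≡y⇒x-y≡0 eq)

  ·−≡0⇒·-≡ : v · (x − y) ≡ 0# → v · x ≡ v · y
  ·−≡0⇒·-≡ {v} {x} {y} eq = x-y≡0⇒x≡y (trans (sym (·-distribˡ-− v x y)) eq)

  x−x≡0 : ∀ x → x − x ≡ zeroV
  x−x≡0 _ = cong₂ _,_ (x≡y⇒x-y≡0 refl) (cong₂ _,_ (x≡y⇒x-y≡0 refl) (x≡y⇒x-y≡0 refl))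

  −≡0⇒≡ : x − y ≡ zeroV → x ≡ y
  −≡0⇒≡ eq = cong₂ _,_ (x-y≡0⇒x≡y (cong c₁ eq))
                (cong₂ _,_ (x-y≡0⇒x≡y (cong c₂ eq)) (x-y≡0⇒x≡y (cong c₃ eq)))

  ·-scaleʳ : ∀ v μ n → v · scale μ n ≡ μ * (v · n)
  ·-scaleʳ (v₁ , v₂ , v₃) μ (n₁ , n₂ , n₃) =
    solve 7 (λ v₁ v₂ v₃ μ n₁ n₂ n₃ →
      v₁ :* (μ :* n₁) :+ v₂ :* (μ :* n₂) :+ v₃ :* (μ :* n₃)
        := μ :* (v₁ :* n₁ :+ v₂ :* n₂ :+ v₃ :* n₃))
      refl v₁ v₂ v₃ μ n₁ n₂ n₃

  scale-0# : ∀ n → scale 0# n ≡ zeroV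
  scale-0# (n₁ , n₂ , n₃) = cong₂ _,_ (zeroˡ n₁) (cong₂ _,_ (zeroˡ n₂) (zeroˡ n₃))

  e₁-· : ∀ v → e₁ · v ≡ c₁ v
  e₁-· (v₁ , v₂ , v₃) = begin
    1# * v₁ + 0# * v₂ + 0# * v₃   ≡⟨ cong₂ (λ s t → s + t + 0# * v₃) (*-identityˡ v₁) (zeroˡ v₂) ⟩
    v₁ + 0# + 0# * v₃             ≡⟨ cong₂ _+_ (+-identityʳ v₁) (zeroˡ v₃) ⟩
    v₁ + 0#                       ≡⟨ +-identityʳ v₁ ⟩
    v₁                            ∎

  e₂-· : ∀ v → e₂ · v ≡ c₂ v
  e₂-· (v₁ , v₂ , v₃) = begin
    0# * v₁ + 1# * v₂ + 0# * v₃   ≡⟨ cong₂ (λ s t → s + t + 0# * v₃) (zeroˡ v₁) (*-identityˡ v₂) ⟩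
    0# + v₂ + 0# * v₃             ≡⟨ cong₂ _+_ (+-identityˡ v₂) (zeroˡ v₃) ⟩
    v₂ + 0#                       ≡⟨ +-identityʳ v₂ ⟩
    v₂                            ∎

  vector-triple-product : ∀ u A B → u ⨯ (A ⨯ B) ≡ scale (u · B) A − scale (u · A) B
  vector-triple-product (u₁ , u₂ , u₃) (A₁ , A₂ , A₃) (B₁ , B₂ , B₃) =
    cong₂ _,_
      (solve 9 (λ u₁ u₂ u₃ A₁ A₂ A₃ B₁ B₂ B₃ →
         u₂ :* (A₁ :* B₂ :- A₂ :* B₁) :- u₃ :* (A₃ :* B₁ :- A₁ :* B₃)
           := (u₁ :* B₁ :+ u₂ :* B₂ :+ u₃ :* B₃) :* A₁ :- (u₁ :* A₁ :+ u₂ :* A₂ :+ u₃ :* A₃) :* B₁)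
         refl u₁ u₂ u₃ A₁ A₂ A₃ B₁ B₂ B₃)
    (cong₂ _,_
      (solve 9 (λ u₁ u₂ u₃ A₁ A₂ A₃ B₁ B₂ B₃ →
         u₃ :* (A₂ :* B₃ :- A₃ :* B₂) :- u₁ :* (A₁ :* B₂ :- A₂ :* B₁)
           := (u₁ :* B₁ :+ u₂ :* B₂ :+ u₃ :* B₃) :* A₂ :- (u₁ :* A₁ :+ u₂ :* A₂ :+ u₃ :* A₃) :* B₂)
         refl u₁ u₂ u₃ A₁ A₂ A₃ B₁ B₂ B₃)
      (solve 9 (λ u₁ u₂ u₃ A₁ A₂ A₃ B₁ B₂ B₃ →
         u₁ :* (A₃ :* B₁ :- A₁ :* B₃) :- u₂ :* (A₂ :* B₃ :- A₃ :* B₂)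
           := (u₁ :* B₁ :+ u₂ :* B₂ :+ u₃ :* B₃) :* A₃ :- (u₁ :* A₁ :+ u₂ :* A₂ :+ u₃ :* A₃) :* B₃)
         refl u₁ u₂ u₃ A₁ A₂ A₃ B₁ B₂ B₃))

  ⨯-orthogonal : A · u ≡ 0# → B · u ≡ 0# → u ⨯ (A ⨯ B) ≡ zeroV
  ⨯-orthogonal {A} {u} {B} Au≡0 Bu≡0 = begin
    u ⨯ (A ⨯ B)                         ≡⟨ vector-triple-product u A B ⟩
    scale (u · B) A − scale (u · A) B   ≡⟨ cong₂ (λ s t → scale s A − scale t B)
                                            (trans (·-comm u B) Bu≡0) (trans (·-comm u A) Au≡0) ⟩
    scale 0# A − scale 0# B             ≡⟨ cong₂ _−_ (scale-0# A) (scale-0# B) ⟩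
    zeroV − zeroV                       ≡⟨ x−x≡0 zeroV ⟩
    zeroV                               ∎

  -- Rotating coordinates commutes with _⨯_ and scale definitionally, which reduces
  -- ⨯≡0⇒multiple to the case of a nonzero first coordinate.
  rotate : Vec3 → Vec3
  rotate (x₁ , x₂ , x₃) = (x₂ , x₃ , x₁)

  ⨯≡0⇒multiple₁ : c₁ n ≢ 0# → u ⨯ n ≡ zeroV → ∃ λ μ → u ≡ scale μ n
  ⨯≡0⇒multiple₁ {n = n₁ , n₂ , n₃} {u = u₁ , u₂ , u₃} n₁≢0 u⨯n≡0
    with n₁⁻¹ , n₁n₁⁻¹≡1 ← inverse n₁ n₁≢0 =
    u₁ * n₁⁻¹ , cong₂ _,_ (ratio refl)
                  (cong₂ _,_ (ratio (sym (x-y≡0⇒x≡y (cong c₃ u⨯n≡0))))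
                             (ratio (x-y≡0⇒x≡y (cong c₂ u⨯n≡0))))
    where
    ratio : ∀ {uᵢ nᵢ} → uᵢ * n₁ ≡ u₁ * nᵢ → uᵢ ≡ u₁ * n₁⁻¹ * nᵢ
    ratio = x*b≡y*c⇒x≡y*b⁻¹*c n₁n₁⁻¹≡1

  unrotate-multiple : (∃ λ μ → rotate u ≡ scale μ (rotate n)) → ∃ λ μ → u ≡ scale μ n
  unrotate-multiple (μ , eq) = μ , cong (rotate ∘ rotate) eq

  ⨯≡0⇒multiple : n ≢ zeroV → u ⨯ n ≡ zeroV → ∃ λ μ → u ≡ scale μ n
  ⨯≡0⇒multiple {n} {u} n≢0 u⨯n≡0 with c₁ n ≟ 0# | c₂ n ≟ 0# | c₃ n ≟ 0#
  ... | no n₁≢0 | _       | _       = ⨯≡0⇒multiple₁ n₁≢0 u⨯n≡0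
  ... | yes _   | no n₂≢0 | _       =
    unrotate-multiple (⨯≡0⇒multiple₁ {rotate n} {rotate u} n₂≢0 (cong rotate u⨯n≡0))
  ... | yes _   | yes _   | no n₃≢0 =
    unrotate-multiple (unrotate-multiple
      (⨯≡0⇒multiple₁ {rotate (rotate n)} {rotate (rotate u)} n₃≢0 (cong (rotate ∘ rotate) u⨯n≡0)))
  ... | yes n₁≡0 | yes n₂≡0 | yes n₃≡0 = ⊥-elim (n≢0 (cong₂ _,_ n₁≡0 (cong₂ _,_ n₂≡0 n₃≡0)))

  multiples-orthogonal : ∀ {μ ν} → u ≡ scale μ n → w ≡ scale ν n → w ≢ zeroV →
                         v · w ≡ 0# → v · u ≡ 0#
  multiples-orthogonal {n = n} {v = v} {μ} {ν} refl refl w≢0 vw≡0 with ν ≟ 0#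
  ... | yes refl = ⊥-elim (w≢0 (scale-0# n))
  ... | no ν≢0   = begin
    v · scale μ n   ≡⟨ ·-scaleʳ v μ n ⟩
    μ * (v · n)     ≡⟨ cong (μ *_) vn≡0 ⟩
    μ * 0#          ≡⟨ zeroʳ μ ⟩
    0#              ∎
    where
    vn≡0 : v · n ≡ 0#
    vn≡0 = *-cancelˡ ν≢0 (trans (sym (·-scaleʳ v ν n)) (trans vw≡0 (sym (zeroʳ ν))))

  ⨯≡0⇒LinDep : c₁ b ≢ 0# → a ⨯ b ≡ zeroV → LinDep a b
  ⨯≡0⇒LinDep {b = b₁ , b₂ , b₃} {a = a₁ , a₂ , a₃} b₁≢0 a⨯b≡0 =
    b₁ , - a₁ , inj₁ b₁≢0 ,
    cong₂ _,_ (vanishes refl)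
      (cong₂ _,_ (vanishes (sym (x-y≡0⇒x≡y (cong c₃ a⨯b≡0))))
                 (vanishes (x-y≡0⇒x≡y (cong c₂ a⨯b≡0))))
    where
    vanishes : ∀ {aᵢ bᵢ} → aᵢ * b₁ ≡ a₁ * bᵢ → b₁ * aᵢ + - a₁ * bᵢ ≡ 0#
    vanishes {aᵢ} {bᵢ} eq = trans
      (solve 4 (λ a₁ b₁ aᵢ bᵢ → b₁ :* aᵢ :+ (:- a₁) :* bᵢ := aᵢ :* b₁ :- a₁ :* bᵢ) refl a₁ b₁ aᵢ bᵢ)
      (x≡y⇒x-y≡0 eq)

  ⨯e₁≡0⇒c₂≡0×c₃≡0 : v ⨯ e₁ ≡ zeroV → c₂ v ≡ 0# × c₃ v ≡ 0#
  ⨯e₁≡0⇒c₂≡0×c₃≡0 {v = v₁ , v₂ , v₃} eq =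
    vanishes (sym (x-y≡0⇒x≡y (cong c₃ eq))) , vanishes (x-y≡0⇒x≡y (cong c₂ eq))
    where
    vanishes : ∀ {t} → t * 1# ≡ v₁ * 0# → t ≡ 0#
    vanishes {t} eq = trans (sym (*-identityʳ t)) (trans eq (zeroʳ v₁))

  InV⇒⨯e₁≢0 : InV a → a ⨯ e₁ ≢ zeroV
  InV⇒⨯e₁≢0 (_ , _ , a₃≢0) eq = a₃≢0 (proj₂ (⨯e₁≡0⇒c₂≡0×c₃≡0 eq))

  ⊥-InV⇒⨯e₁≢0 : InV x → v · x ≡ 0# → v ≢ zeroV → v ⨯ e₁ ≢ zeroV
  ⊥-InV⇒⨯e₁≢0 {x = x₁ , x₂ , x₃} {v = v₁ , v₂ , v₃} (x₁≢0 , _) vx≡0 v≢0 v⨯e₁≡0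
    with refl , refl ← ⨯e₁≡0⇒c₂≡0×c₃≡0 v⨯e₁≡0 = v≢0 (cong (_, 0# , 0#) v₁≡0)
    where
    v₁≡0 : v₁ ≡ 0#
    v₁≡0 = *-cancelˡ x₁≢0 (begin
      x₁ * v₁                         ≡⟨ *-comm x₁ v₁ ⟩
      v₁ * x₁                         ≡⟨ +-identityʳ _ ⟨
      v₁ * x₁ + 0#                    ≡⟨ +-identityʳ _ ⟨
      v₁ * x₁ + 0# + 0#               ≡⟨ cong₂ (λ s t → v₁ * x₁ + s + t) (zeroˡ x₂) (zeroˡ x₃) ⟨
      v₁ * x₁ + 0# * x₂ + 0# * x₃     ≡⟨ vx≡0 ⟩
      0#                              ≡⟨ zeroʳ x₁ ⟨
      x₁ * 0#                         ∎)

  quadrics⇒−·≡0 : a · x ≡ x · x → b · x ≡ x · x → (a − b) · x ≡ 0#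
  quadrics⇒−·≡0 {a} {x} {b} ax≡xx bx≡xx =
    trans (·-distribʳ-− a b x) (x≡y⇒x-y≡0 (trans ax≡xx (sym bx≡xx)))

  SameLevel : Vec3 → Vec3 → Vec3 → Vec3 → Set
  SameLevel A x y z = A · x ≡ A · y × A · y ≡ A · z

  level : ∀ {k} → A · x ≡ k → A · y ≡ k → A · z ≡ k → SameLevel A x y z
  level Ax Ay Az = trans Ax (sym Ay) , trans Ay (sym Az)

  c₁-level : c₁ x ≡ c₁ y → c₁ y ≡ c₁ z → SameLevel e₁ x y z
  c₁-level {x} {y} {z} x₁≡y₁ y₁≡z₁ =
    level (trans (e₁-· x) x₁≡y₁) (e₁-· y) (trans (e₁-· z) (sym y₁≡z₁))

  -- When y ≢ z, this says that x lies on the line through y and z.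
  OnLine : Vec3 → Vec3 → Vec3 → Set
  OnLine x y z = ∀ v → v · y ≡ v · z → v · x ≡ v · y

  levels⇒OnLine : SameLevel A x y z → SameLevel B x y z → A ⨯ B ≢ zeroV → y ≢ z → OnLine x y z
  levels⇒OnLine {A} {x} {y} {z} {B} (Ax≡Ay , Ay≡Az) (Bx≡By , By≡Bz) A⨯B≢0 y≢z v vy≡vz =
    sym (·−≡0⇒·-≡ (multiples-orthogonal (proj₂ (direction (sym Ax≡Ay) (sym Bx≡By)))
                                        (proj₂ (direction Ay≡Az By≡Bz))
                                        (y≢z ∘ −≡0⇒≡) (·-≡⇒·−≡0 vy≡vz)))
    where
    direction : ∀ {p} → A · y ≡ A · p → B · y ≡ B · p → ∃ λ μ → y − p ≡ scale μ (A ⨯ B)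
    direction Ay≡Ap By≡Bp =
      ⨯≡0⇒multiple A⨯B≢0 (⨯-orthogonal (·-≡⇒·−≡0 Ay≡Ap) (·-≡⇒·−≡0 By≡Bp))

  OnLine-coordinate : ∀ e (g : Vec3 → Carrier) → (∀ p → e · p ≡ g p) →
                      OnLine x y z → g y ≡ g z → g x ≡ g y
  OnLine-coordinate {x} {y} {z} e g e·≡g on-line gy≡gz = begin
    g x     ≡⟨ e·≡g x ⟨
    e · x   ≡⟨ on-line e (trans (e·≡g y) (trans gy≡gz (sym (e·≡g z)))) ⟩
    e · y   ≡⟨ e·≡g y ⟩
    g y     ∎

  data Locus (a x y z : Vec3) : Set where
    plane   : SameLevel a x y z → Locus a x y z
    quadric : a · x ≡ x · x → a · y ≡ y · y → a · z ≡ z · z → SameLevel e₁ x y z → Locus a x y z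

  -- The quadrics a · p = p · p and b · p = p · p meet in the plane (a − b) · p = 0.
  common-line : InV a → InV b → InV x → a ≢ b → ¬ LinDep a b → Locus a x y z → Locus b x y z →
                ∃₂ λ A B → SameLevel A x y z × SameLevel B x y z × A ⨯ B ≢ zeroV
  common-line {a} {b} _ vb _ _ a∦b (plane ℓa) (plane ℓb) =
    a , b , ℓa , ℓb , a∦b ∘ ⨯≡0⇒LinDep (proj₁ vb)
  common-line {a} va _ _ _ _ (plane ℓa) (quadric _ _ _ ℓ) = a , e₁ , ℓa , ℓ , InV⇒⨯e₁≢0 va
  common-line {b = b} _ vb _ _ _ (quadric _ _ _ ℓ) (plane ℓb) = b , e₁ , ℓb , ℓ , InV⇒⨯e₁≢0 vb
  common-line {a} {b} _ _ vx a≢b _ (quadric ax ay az ℓ) (quadric bx by bz _) =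
    a − b , e₁ ,
    level (quadrics⇒−·≡0 ax bx) (quadrics⇒−·≡0 ay by) (quadrics⇒−·≡0 az bz) , ℓ ,
    ⊥-InV⇒⨯e₁≢0 vx (quadrics⇒−·≡0 ax bx) (a≢b ∘ −≡0⇒≡)

  vieta : ∀ {a₁ a₂ a₃ p₁ p₂ s t} → s ≢ t →
          (a₁ , a₂ , a₃) · (p₁ , p₂ , s) ≡ (p₁ , p₂ , s) · (p₁ , p₂ , s) →
          (a₁ , a₂ , a₃) · (p₁ , p₂ , t) ≡ (p₁ , p₂ , t) · (p₁ , p₂ , t) → a₃ ≡ s + t
  vieta {a₁} {a₂} {a₃} {p₁} {p₂} {s} {t} s≢t as≡ss at≡tt = *-cancelˡ (s≢t ∘ x-y≡0⇒x≡y) (begin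
    (s + - t) * a₃
      ≡⟨ solve 7 (λ a₁ a₂ a₃ p₁ p₂ s t →
           (s :- t) :* a₃ := a₁ :* p₁ :+ a₂ :* p₂ :+ a₃ :* s :- (a₁ :* p₁ :+ a₂ :* p₂ :+ a₃ :* t))
           refl a₁ a₂ a₃ p₁ p₂ s t ⟩
    a₁ * p₁ + a₂ * p₂ + a₃ * s + - (a₁ * p₁ + a₂ * p₂ + a₃ * t)
      ≡⟨ cong₂ (λ l r → l + - r) as≡ss at≡tt ⟩
    p₁ * p₁ + p₂ * p₂ + s * s + - (p₁ * p₁ + p₂ * p₂ + t * t)
      ≡⟨ solve 4 (λ p₁ p₂ s t →
           p₁ :* p₁ :+ p₂ :* p₂ :+ s :* s :- (p₁ :* p₁ :+ p₂ :* p₂ :+ t :* t)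
             := (s :- t) :* (s :+ t))
           refl p₁ p₂ s t ⟩
    (s + - t) * (s + t)
      ∎)

  third-≢ : ∀ {p₁ p₂ s t : Carrier} → (p₁ , p₂ , s) ≢ (p₁ , p₂ , t) → s ≢ t
  third-≢ {p₁} {p₂} p≢q = p≢q ∘ cong (λ t → p₁ , p₂ , t)

  ¬three-on-vertical-line : ∀ {p₁ p₂ s t r} → InV a →
                            Locus a (p₁ , p₂ , s) (p₁ , p₂ , t) (p₁ , p₂ , r) →
                            s ≢ t → s ≢ r → t ≢ r → ⊥
  ¬three-on-vertical-line (_ , _ , a₃≢0) (plane (_ , at≡ar)) _ _ t≢r =
    t≢r (*-cancelˡ a₃≢0 (+-cancelˡ at≡ar))
  ¬three-on-vertical-line _ (quadric as≡ss at≡tt ar≡rr _) s≢t s≢r t≢r =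
    t≢r (+-cancelˡ (trans (sym (vieta s≢t as≡ss at≡tt)) (vieta s≢r as≡ss ar≡rr)))

  data Agree (x y z : Vec3) : Set where
    dot-agree    : x · y ≡ x · z → x · y ≢ x · x → Agree x y z
    first-agree  : c₁ x ≢ c₁ y → c₁ y ≡ c₁ z → Agree x y z
    second-agree : c₁ x ≡ c₁ y → c₁ x ≡ c₁ z → c₂ y ≡ c₂ z → Agree x y z

  OnLine⇒¬Agree : InV a → Locus a x y z → x ≢ y → x ≢ z → y ≢ z → OnLine x y z → ¬ Agree x y z
  OnLine⇒¬Agree {x = x} _ _ _ _ _ on-line (dot-agree xy≡xz xy≢xx) =
    xy≢xx (sym (on-line x xy≡xz))
  OnLine⇒¬Agree _ _ _ _ _ on-line (first-agree x₁≢y₁ y₁≡z₁) =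
    x₁≢y₁ (OnLine-coordinate e₁ c₁ e₁-· on-line y₁≡z₁)
  OnLine⇒¬Agree {x = _ , _ , _} {y = _ , _ , _} {z = _ , _ , _} va ℓa x≢y x≢z y≢z on-line
                (second-agree refl refl refl)
    with refl ← OnLine-coordinate e₂ c₂ e₂-· on-line refl =
    ¬three-on-vertical-line va ℓa (third-≢ x≢y) (third-≢ x≢z) (third-≢ y≢z)

  ¬Agree : InV a → InV b → InV x → a ≢ b → ¬ LinDep a b → x ≢ y → x ≢ z → y ≢ z →
           Locus a x y z → Locus b x y z → ¬ Agree x y z
  ¬Agree va vb vx a≢b a∦b x≢y x≢z y≢z ℓa ℓb
    with A , B , ℓA , ℓB , A⨯B≢0 ← common-line va vb vx a≢b a∦b ℓa ℓb =
    OnLine⇒¬Agree va ℓa x≢y x≢z y≢z (levels⇒OnLine ℓA ℓB A⨯B≢0 y≢z)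

module EdgeColors {q : ℕ} (F : FiniteField q) {_<_ : Rel (FiniteField.Carrier F) 0ℓ}
                  (sto : IsStrictTotalOrder _≡_ _<_) where

  open FiniteField F
  open FieldFacts F
  open Coloring F sto
  open Geometry F sto
  open IsStrictTotalOrder sto using (irrefl; asym; _<?_)

  private
    variable a b x y z w p : Vec3
    module Lex = IsStrictTotalOrder (×-isStrictTotalOrder sto (×-isStrictTotalOrder sto sto))

  <ₗ-connex : x ≢ y → ¬ x <ₗ y → y <ₗ x
  <ₗ-connex {x} {y} x≢y x≮y with Lex.compare x y
  ... | tri< x<y _ _                 = ⊥-elim (x≮y x<y)
  ... | tri≈ _ (x₁≡y₁ , x₂₃≡y₂₃) _ = ⊥-elim (x≢y (≡×≡⇒≡ (x₁≡y₁ , ≡×≡⇒≡ x₂₃≡y₂₃)))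
  ... | tri> _ _ y<x                 = y<x

  χ₁-sym : x ≢ y → χ₁ x y ≡ χ₁ y x
  χ₁-sym {x} {y} x≢y with x <ₗ? y | y <ₗ? x
  ... | yes x<y | yes y<x = ⊥-elim (Lex.asym x<y y<x)
  ... | yes _   | no _    = refl
  ... | no _    | yes _   = refl
  ... | no x≮y  | no y≮x  = ⊥-elim (y≮x (<ₗ-connex x≢y x≮y))

  lex-first : x <ₗ y → ¬ c₁ x < c₁ y → c₁ x ≡ c₁ y
  lex-first (inj₁ x₁<y₁)       x₁≮y₁ = ⊥-elim (x₁≮y₁ x₁<y₁)
  lex-first (inj₂ (x₁≡y₁ , _)) _     = x₁≡y₁

  lex-second : x <ₗ y → ¬ c₁ x < c₁ y → (c₂ x ≡ c₂ y → c₃ x ≡ c₃ y) → c₂ x < c₂ y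
  lex-second (inj₁ x₁<y₁)                      x₁≮y₁ _            = ⊥-elim (x₁≮y₁ x₁<y₁)
  lex-second (inj₂ (_ , inj₁ x₂<y₂))           _     _            = x₂<y₂
  lex-second (inj₂ (_ , inj₂ (x₂≡y₂ , x₃<y₃))) _     x₂≡y₂⇒x₃≡y₃ = ⊥-elim (irrefl (x₂≡y₂⇒x₃≡y₃ x₂≡y₂) x₃<y₃)

  x·y≡x·x⇒c₃x≡c₃y : c₁ x ≡ c₁ y → c₂ x ≡ c₂ y → x · y ≡ x · x → c₃ x ≢ 0# → c₃ x ≡ c₃ y
  x·y≡x·x⇒c₃x≡c₃y {x = x₁ , x₂ , x₃} refl refl xy≡xx x₃≢0 =
    sym (*-cancelˡ x₃≢0 (+-cancelˡ xy≡xx))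

  data Shape : EdgeType → Vec3 → Vec3 → Set where
    up₁        : x · y ≡ x · x → c₁ x < c₁ y → Shape UP₁ x y
    up₂        : x · y ≡ x · x → c₁ x ≡ c₁ y → c₂ x < c₂ y → Shape UP₂ x y
    down₁      : x · y ≡ y · y → c₁ x < c₁ y → Shape DOWN₁ x y
    down₂      : x · y ≡ y · y → c₁ x ≡ c₁ y → c₂ x < c₂ y → Shape DOWN₂ x y
    orthogonal : x · y ≡ 0# → x · y ≢ x · x → x · y ≢ y · y → Shape ZERO x y
    plain      : x · y ≢ x · x → x · y ≢ y · y → Shape DOT x y

  shape : InV x → InV y → x <ₗ y → Shape (T x y) x y
  shape {x} {y} (_ , _ , x₃≢0) (_ , _ , y₃≢0) x<y
    with (x · y) ≟ (x · x) | (x · y) ≟ (y · y) | c₁ x <? c₁ y | c₁ x ≟ c₁ y | x <ₗ? y | (x · y) ≟ 0#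
  ... | _         | _         | _         | _         | no x≮y | _ = ⊥-elim (x≮y x<y)
  ... | yes xy≡xx | _         | yes x₁<y₁ | _         | yes _  | _ = up₁ xy≡xx x₁<y₁
  ... | yes xy≡xx | _         | no x₁≮y₁  | yes x₁≡y₁ | yes _  | _ =
    up₂ xy≡xx x₁≡y₁ (lex-second x<y x₁≮y₁ λ x₂≡y₂ → x·y≡x·x⇒c₃x≡c₃y x₁≡y₁ x₂≡y₂ xy≡xx x₃≢0)
  ... | yes _     | _         | no x₁≮y₁  | no x₁≢y₁  | yes _  | _ = ⊥-elim (x₁≢y₁ (lex-first x<y x₁≮y₁))
  ... | no _      | yes xy≡yy | yes x₁<y₁ | _         | yes _  | _ = down₁ xy≡yy x₁<y₁
  ... | no _      | yes xy≡yy | no x₁≮y₁  | yes x₁≡y₁ | yes _  | _ =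
    down₂ xy≡yy x₁≡y₁ (lex-second x<y x₁≮y₁ λ x₂≡y₂ →
      sym (x·y≡x·x⇒c₃x≡c₃y (sym x₁≡y₁) (sym x₂≡y₂) (trans (·-comm y x) xy≡yy) y₃≢0))
  ... | no _      | yes _     | no x₁≮y₁  | no x₁≢y₁  | yes _  | _ = ⊥-elim (x₁≢y₁ (lex-first x<y x₁≮y₁))
  ... | no xy≢xx  | no xy≢yy  | _         | _         | yes _  | yes xy≡0 = orthogonal xy≡0 xy≢xx xy≢yy
  ... | no xy≢xx  | no xy≢yy  | _         | _         | yes _  | no _     = plain xy≢xx xy≢yy

  <⇒≢ : ∀ {s t} → s < t → s ≢ t
  <⇒≢ s<t s≡t = irrefl s≡t s<t

  below : ∀ {s t} → s < t → s < (s + t + - s)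
  below {s} {t} = subst (s <_) (sym (x+y-x≡y s t))

  not-below : ∀ {s t} → s < t → ¬ t < (s + t + - t)
  not-below {s} {t} s<t t<s+t-t = asym s<t (subst (t <_) (x+y-y≡x s t) t<s+t-t)

  data Constraint : Set where
    dot lin₁ quad₁ lin₂ quad₂ : Carrier → Constraint

  Holds : Constraint → Vec3 → Vec3 → Set
  Holds (dot s)   w p = w · p ≡ s × w · p ≢ w · w
  Holds (lin₁ s)  w p = c₁ w + c₁ p ≡ s × c₁ w ≢ c₁ p × w · p ≡ w · w
  Holds (quad₁ s) w p = c₁ w + c₁ p ≡ s × c₁ w ≢ c₁ p × w · p ≡ p · p
  Holds (lin₂ s)  w p = c₁ w ≡ c₁ p × c₂ w + c₂ p ≡ s × w · p ≡ w · w
  Holds (quad₂ s) w p = c₁ w ≡ c₁ p × c₂ w + c₂ p ≡ s × w · p ≡ p · p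

  -- For UP/DOWN colors with value s the other endpoint has cᵢ p = s − cᵢ w, so w alone
  -- decides whether it is the lower or the upper endpoint of the edge.
  constraint : Vec3 → Color → Constraint
  constraint w (UP₁   , s , _) = if does (c₁ w <? s + - c₁ w) then lin₁ s  else quad₁ s
  constraint w (DOWN₁ , s , _) = if does (c₁ w <? s + - c₁ w) then quad₁ s else lin₁ s
  constraint w (UP₂   , s , _) = if does (c₂ w <? s + - c₂ w) then lin₂ s  else quad₂ s
  constraint w (DOWN₂ , s , _) = if does (c₂ w <? s + - c₂ w) then quad₂ s else lin₂ s
  constraint w (ZERO  , _ , _) = dot 0#
  constraint w (DOT   , s , _) = dot s

  Holds-if-yes : ∀ {P : Set} (d : Dec P) {k k′} → P → Holds k w p →
                 Holds (if does d then k else k′) w p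
  Holds-if-yes (yes _) _ h = h
  Holds-if-yes (no ¬P) P _ = ⊥-elim (¬P P)

  Holds-if-no : ∀ {P : Set} (d : Dec P) {k k′} → ¬ P → Holds k′ w p →
                Holds (if does d then k else k′) w p
  Holds-if-no (yes P) ¬P _ = ⊥-elim (¬P P)
  Holds-if-no (no _)  _  h = h

  holds-lower : ∀ {t n} → Shape t x y → Holds (constraint x (t , f t x y , n)) x y
  holds-lower {x} {y} (up₁ xy≡xx x₁<y₁) =
    Holds-if-yes (c₁ x <? c₁ x + c₁ y + - c₁ x) (below x₁<y₁) (refl , <⇒≢ x₁<y₁ , xy≡xx)
  holds-lower {x} {y} (up₂ xy≡xx x₁≡y₁ x₂<y₂) =
    Holds-if-yes (c₂ x <? c₂ x + c₂ y + - c₂ x) (below x₂<y₂) (x₁≡y₁ , refl , xy≡xx)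
  holds-lower {x} {y} (down₁ xy≡yy x₁<y₁) =
    Holds-if-yes (c₁ x <? c₁ x + c₁ y + - c₁ x) (below x₁<y₁) (refl , <⇒≢ x₁<y₁ , xy≡yy)
  holds-lower {x} {y} (down₂ xy≡yy x₁≡y₁ x₂<y₂) =
    Holds-if-yes (c₂ x <? c₂ x + c₂ y + - c₂ x) (below x₂<y₂) (x₁≡y₁ , refl , xy≡yy)
  holds-lower (orthogonal xy≡0 xy≢xx _) = xy≡0 , xy≢xx
  holds-lower (plain xy≢xx _)           = refl , xy≢xx

  holds-upper : ∀ {t n} → Shape t x y → Holds (constraint y (t , f t x y , n)) y x
  holds-upper {x} {y} (up₁ xy≡xx x₁<y₁) =
    Holds-if-no (c₁ y <? c₁ x + c₁ y + - c₁ y) (not-below x₁<y₁)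
      (+-comm (c₁ y) (c₁ x) , <⇒≢ x₁<y₁ ∘ sym , trans (·-comm y x) xy≡xx)
  holds-upper {x} {y} (up₂ xy≡xx x₁≡y₁ x₂<y₂) =
    Holds-if-no (c₂ y <? c₂ x + c₂ y + - c₂ y) (not-below x₂<y₂)
      (sym x₁≡y₁ , +-comm (c₂ y) (c₂ x) , trans (·-comm y x) xy≡xx)
  holds-upper {x} {y} (down₁ xy≡yy x₁<y₁) =
    Holds-if-no (c₁ y <? c₁ x + c₁ y + - c₁ y) (not-below x₁<y₁)
      (+-comm (c₁ y) (c₁ x) , <⇒≢ x₁<y₁ ∘ sym , trans (·-comm y x) xy≡yy)
  holds-upper {x} {y} (down₂ xy≡yy x₁≡y₁ x₂<y₂) =
    Holds-if-no (c₂ y <? c₂ x + c₂ y + - c₂ y) (not-below x₂<y₂)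
      (sym x₁≡y₁ , +-comm (c₂ y) (c₂ x) , trans (·-comm y x) xy≡yy)
  holds-upper {x} {y} (orthogonal xy≡0 _ xy≢yy) =
    trans (·-comm y x) xy≡0 , xy≢yy ∘ trans (·-comm x y)
  holds-upper {x} {y} (plain _ xy≢yy) = ·-comm y x , xy≢yy ∘ trans (·-comm x y)

  χ₁-holds : w ≢ p → InV w → InV p → Holds (constraint w (χ₁ w p)) w p
  χ₁-holds {w} {p} w≢p vw vp with w <ₗ? p
  ... | yes w<p = holds-lower (shape vw vp w<p)
  ... | no  w≮p = holds-upper (shape vp vw (<ₗ-connex w≢p w≮p))

  χ₁-holds-at : ∀ {κ} → χ₁ w p ≡ κ → w ≢ p → InV w → InV p → Holds (constraint w κ) w p
  χ₁-holds-at refl = χ₁-holds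

  locus : ∀ {k} → Holds k a x → Holds k a y → Holds k a z → Locus a x y z
  locus {k = dot _}   (ax , _)      (ay , _)      (az , _)      = plane (level ax ay az)
  locus {k = lin₁ _}  (_ , _ , ax)  (_ , _ , ay)  (_ , _ , az)  = plane (level ax ay az)
  locus {k = lin₂ _}  (_ , _ , ax)  (_ , _ , ay)  (_ , _ , az)  = plane (level ax ay az)
  locus {k = quad₁ _} (sx , _ , ax) (sy , _ , ay) (sz , _ , az) =
    quadric ax ay az (c₁-level (+-cancelˡ (trans sx (sym sy))) (+-cancelˡ (trans sy (sym sz))))
  locus {k = quad₂ _} (a₁≡x₁ , _ , ax) (a₁≡y₁ , _ , ay) (a₁≡z₁ , _ , az) =
    quadric ax ay az (c₁-level (trans (sym a₁≡x₁) a₁≡y₁) (trans (sym a₁≡y₁) a₁≡z₁))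

  agree : ∀ {k} → Holds k x y → Holds k x z → Agree x y z
  agree {k = dot _}   (xy≡s , xy≢xx) (xz≡s , _) = dot-agree (trans xy≡s (sym xz≡s)) xy≢xx
  agree {k = lin₁ _}  (sy , x₁≢y₁ , _) (sz , _) = first-agree x₁≢y₁ (+-cancelˡ (trans sy (sym sz)))
  agree {k = quad₁ _} (sy , x₁≢y₁ , _) (sz , _) = first-agree x₁≢y₁ (+-cancelˡ (trans sy (sym sz)))
  agree {k = lin₂ _}  (x₁≡y₁ , sy , _) (x₁≡z₁ , sz , _) =
    second-agree x₁≡y₁ x₁≡z₁ (+-cancelˡ (trans sy (sym sz)))
  agree {k = quad₂ _} (x₁≡y₁ , sy , _) (x₁≡z₁ , sz , _) =
    second-agree x₁≡y₁ x₁≡z₁ (+-cancelˡ (trans sy (sym sz)))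

  ¬same-color : InV a → InV b → a ≢ b → ¬ LinDep a b →
                 InV x → InV y → InV z → x ≢ y → x ≢ z → y ≢ z →
                 Locus a x y z → Locus b x y z → χ₁ x y ≢ χ₁ x z
  ¬same-color va vb a≢b a∦b vx vy vz x≢y x≢z y≢z ℓa ℓb xy≡xz =
    ¬Agree va vb vx a≢b a∦b x≢y x≢z y≢z ℓa ℓb
      (agree (χ₁-holds x≢y vx vy) (χ₁-holds-at (sym xy≡xz) x≢z vx vz))

mainTheorem12 :
    (q : ℕ) → (∃₂ λ p k → Prime p × q ≡ p ^ suc k) → ¬ (2 ∣ q) →
    (F : FiniteField q) →
    (_<_ : Rel (FiniteField.Carrier F) 0ℓ) → (sto : IsStrictTotalOrder _≡_ _<_) →
    (a b c d e : Coloring.Vec3 F sto) →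
    Coloring.InV F sto a → Coloring.InV F sto b → Coloring.InV F sto c →
    Coloring.InV F sto d → Coloring.InV F sto e →
    a ≢ b → a ≢ c → a ≢ d → a ≢ e → b ≢ c → b ≢ d → b ≢ e →
    c ≢ d → c ≢ e → d ≢ e →
    ¬ Coloring.LinDep F sto a b →
    Coloring.χ₁ F sto a c ≡ Coloring.χ₁ F sto a d →
    Coloring.χ₁ F sto a d ≡ Coloring.χ₁ F sto a e →
    Coloring.χ₁ F sto b c ≡ Coloring.χ₁ F sto b d →
    Coloring.χ₁ F sto b d ≡ Coloring.χ₁ F sto b e →
    (Coloring.χ₁ F sto c d ≢ Coloring.χ₁ F sto c e)
      × (Coloring.χ₁ F sto c d ≢ Coloring.χ₁ F sto d e)
      × (Coloring.χ₁ F sto c e ≢ Coloring.χ₁ F sto d e)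
mainTheorem12 _ _ _ F _ sto a b c d e va vb vc vd ve
              a≢b a≢c a≢d a≢e b≢c b≢d b≢e c≢d c≢e d≢e a∦b ac≡ad ad≡ae bc≡bd bd≡be =
    ¬same-color va vb a≢b a∦b vc vd ve c≢d c≢e d≢e (locus hac had hae) (locus hbc hbd hbe)
  , (λ cd≡de → ¬same-color va vb a≢b a∦b vd vc ve (≢-sym c≢d) d≢e c≢e
                 (locus had hac hae) (locus hbd hbc hbe) (trans (χ₁-sym (≢-sym c≢d)) cd≡de))
  , (λ ce≡de → ¬same-color va vb a≢b a∦b ve vc vd (≢-sym c≢e) (≢-sym d≢e) c≢d
                 (locus hae hac had) (locus hbe hbc hbd)
                 (trans (χ₁-sym (≢-sym c≢e)) (trans ce≡de (χ₁-sym d≢e))))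
  where
  open Coloring F sto
  open EdgeColors F sto
  hac : Holds (constraint a (χ₁ a c)) a c
  hac = χ₁-holds a≢c va vc
  had : Holds (constraint a (χ₁ a c)) a d
  had = χ₁-holds-at (sym ac≡ad) a≢d va vd
  hae : Holds (constraint a (χ₁ a c)) a e
  hae = χ₁-holds-at (sym (trans ac≡ad ad≡ae)) a≢e va ve
  hbc : Holds (constraint b (χ₁ b c)) b c
  hbc = χ₁-holds b≢c vb vc
  hbd : Holds (constraint b (χ₁ b c)) b d
  hbd = χ₁-holds-at (sym bc≡bd) b≢d vb vd
  hbe : Holds (constraint b (χ₁ b c)) b e
  hbe = χ₁-holds-at (sym (trans bc≡bd bd≡be)) b≢e vb ve
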